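{- Let $w$ be a two-dimensional word over the alphabet $\{0,1\}$ such that all positions $(i,j)$ with $w(i,j)\neq\varepsilon$ lie inside some $6\times 6$ square of $\mathbb{Z}^2$. Then $w$ can be extended to be a rich plane.
   Context: A palindrome is a word equal to its reversal (the empty word is a palindrome); a finite word $x$ is rich if it has exactly $|x|+1$ distinct palindromic factors (counting the empty word). A two-dimensional word over an alphabet $A$ is a map $w:\mathbb{Z}^2\to A\cup\{\varepsilon\}$, $\varepsilon$ the empty word. It is rich if for all $i,j\in\mathbb{Z}$ and $n\ge0$ such that the relevant entries are all nonempty, the words $w(i,j)w(i,j+1)\cdots w(i,j+n)$ and $w(i,j)w(i+1,j)\cdots w(i+n,j)$ are rich. $w$ can be extended to be a rich plane if one can assign letters of $A$ to all positions $(i,j)$ with $w(i,j)=\varepsilon$ so that the resulting two-dimensional word (with no empty positions) is rich. -}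

module Defs where

open import Data.Bool using (Bool)
open import Data.Bool.Properties using () renaming (_≟_ to _≟B_)
open import Data.Nat using (ℕ; zero; suc; _+_)
open import Data.Integer using (ℤ; +_) renaming (_+_ to _+ℤ_; _≤_ to _≤ℤ_)
open import Data.List using (List; []; _∷_; reverse; length; take; drop; filter; deduplicate; map; concatMap; upTo)
open import Data.List.Properties using (≡-dec)
open import Data.Maybe using (Maybe; just; nothing)
open import Data.Product using (Σ; _×_; ∃)
open import Relation.Binary.PropositionalEquality using (_≡_; _≢_)
open import Relation.Nullary using (Dec)

Word : Set
Word = List Bool

_≟W_ : (u v : Word) → Dec (u ≡ v)
_≟W_ = ≡-dec _≟B_

IsPalindrome : Word → Set
IsPalindrome x = reverse x ≡ x

isPalindrome? : (x : Word) → Dec (IsPalindrome x)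
isPalindrome? x = reverse x ≟W x

factorsWithRep : Word → List Word
factorsWithRep x =
  [] ∷ concatMap (λ i → map (λ k → take (suc k) (drop i x)) (upTo (length x Data.Nat.∸ i))) (upTo (length x))

palFactors : Word → List Word
palFactors x = deduplicate _≟W_ (filter isPalindrome? (factorsWithRep x))

Rich : Word → Set
Rich x = length (palFactors x) ≡ length x + 1

-- Two-dimensional words: nothing plays the role of the empty word ε.
Word2D : Set
Word2D = ℤ → ℤ → Maybe Bool

Plane : Set
Plane = ℤ → ℤ → Bool

rowWord : Plane → ℤ → ℤ → ℕ → Word
rowWord p i j n = map (λ k → p i (j +ℤ + k)) (upTo (suc n))

colWord : Plane → ℤ → ℤ → ℕ → Word
colWord p i j n = map (λ k → p (i +ℤ + k) j) (upTo (suc n))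

RichPlane : Plane → Set
RichPlane p = ∀ i j n → Rich (rowWord p i j n) × Rich (colWord p i j n)

Extends : Plane → Word2D → Set
Extends p w = ∀ i j (a : Bool) → w i j ≡ just a → p i j ≡ a

CanBeExtendedToRichPlane : Word2D → Set
CanBeExtendedToRichPlane w = Σ Plane λ p → Extends p w × RichPlane p

SupportIn6x6 : Word2D → Set
SupportIn6x6 w = ∃ λ a → ∃ λ b → ∀ i j → w i j ≢ nothing →
  (a ≤ℤ i × i ≤ℤ a +ℤ + 5) × (b ≤ℤ j × j ≤ℤ b +ℤ + 5)

module Submission where

-- Reflect the square with period 10 in both directions: the cell used at coordinate k is
-- 0 1 2 3 4 5 4 3 2 1 according to k mod 10, counted from the corner of the square.  Every row and
-- column Y is then 10-periodic and symmetric about 0 (Y x = Y y whenever x + y ≡ 0 mod 10), and for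
-- such words richness is checked by evaluation on windows of length at most 18, for all 2⁶ lines.
-- Appending a letter to a longer window can only add its longest palindromic suffix u, and u is new:
-- symmetry makes u start within the first 10 letters, so u is longer than a period, and an earlier
-- occurrence of u at distance d would agree with u on a full period, give Y the period d, move the
-- centre of symmetry by d, and so produce a longer palindromic suffix.

open import Defs
open import Data.Bool using (Bool; false; true)
open import Data.Maybe using (nothing; fromMaybe)
open import Data.Nat using (ℕ; zero; suc; _+_; _*_; _∸_; _%_; _<_; _≤_; _≟_; _<?_; s≤s; z≤n)
open import Data.Nat.Properties using (+-comm; +-assoc; +-identityʳ; +-suc; m∸n+n≡m; m+[n∸m]≡n; m+n∸m≡n; m≤m+n; m≤n+m; m<m+n; ∸-mono; +-∸-assoc; ≤-reflexive; ≤-trans; ≤-pred; ≮⇒≥; <⇒≤; <-≤-trans; +-cancelʳ-≤; allUpTo?)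
open import Data.Nat.DivMod using (%-distribˡ-+; m%n%n≡m%n; m%n<n; [m+kn]%n≡m%n; n%n≡0; m<n⇒m%n≡m)
open import Data.Nat.Tactic.RingSolver using (solve-∀)
open import Data.Integer using (ℤ; +_; -[1+_]; -_; _-_; ∣_∣) renaming (_+_ to _+ℤ_; _≤_ to _≤ℤ_)
import Data.Integer.Properties as ℤ
import Data.Integer.Tactic.RingSolver as ℤ-Solver
open import Data.List using (List; []; _∷_; _++_; [_]; _∷ʳ_; reverse; length; take; drop; filter; map; upTo; applyUpTo; initLast; _∷ʳ′_)
open import Data.List.Properties using (∷-injectiveˡ; ∷-injectiveʳ; ++-assoc; ++-identityʳ; reverse-++; unfold-reverse; ∷ʳ-injectiveˡ; take++drop≡id; length-++; length-applyUpTo; applyUpTo-∷ʳ; map-upTo)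
open import Data.List.Membership.Propositional using (_∈_; find; lose)
open import Data.List.Membership.Propositional.Properties
  using (∈-map⁺; ∈-map⁻; ∈-concatMap⁺; ∈-concatMap⁻; ∈-upTo⁺; ∈-filter⁺; ∈-filter⁻; deduplicate-∈⇔; ∈-deduplicate⁻)
open import Data.List.Membership.Propositional.Properties.WithK using (unique∧set⇒bag)
open import Data.List.Relation.Unary.All using (tabulate)
open import Data.List.Relation.Unary.AllPairs using (_∷_)
open import Data.List.Relation.Unary.Any using (here; there)
open import Data.List.Relation.Unary.Unique.Propositional using (Unique)
open import Data.List.Relation.Unary.Unique.DecPropositional.Properties _≟W_ using (deduplicate-!)
open import Data.List.Relation.Binary.BagAndSetEquality using (∼bag⇒↭)
open import Data.List.Relation.Binary.Permutation.Propositional.Properties using (↭-length)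
open import Data.Product using (∃; ∃₂; _×_; _,_; proj₂)
open import Data.Sum using (_⊎_; inj₁; inj₂)
open import Data.Empty using (⊥-elim)
open import Function.Bundles using (mk⇔; Equivalence)
open import Relation.Nullary using (¬_; Dec; yes; no; map′; _×-dec_; _→-dec_; contradiction)
open import Relation.Nullary.Decidable using (toWitness)
open import Relation.Binary.Bundles using (Setoid)
open import Relation.Binary.Structures using (IsEquivalence)
open import Relation.Binary.PropositionalEquality using (_≡_; _≢_; refl; sym; trans; cong; cong₂; subst; subst₂; module ≡-Reasoning)

module _ {A : Set} where

  drop-length-++ : (p u : List A) → drop (length p) (p ++ u) ≡ u
  drop-length-++ []      u = refl
  drop-length-++ (_ ∷ p) u = drop-length-++ p u

  take-length-++ : (u q : List A) → take (length u) (u ++ q) ≡ u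
  take-length-++ []      q = refl
  take-length-++ (a ∷ u) q = cong (a ∷_) (take-length-++ u q)

  applyUpTo-cong : ∀ {f g : ℕ → A} n → (∀ {k} → k < n → f k ≡ g k) → applyUpTo f n ≡ applyUpTo g n
  applyUpTo-cong zero    f≗g = refl
  applyUpTo-cong (suc n) f≗g = cong₂ _∷_ (f≗g (s≤s z≤n)) (applyUpTo-cong n (λ k<n → f≗g (s≤s k<n)))

  applyUpTo-injective : ∀ {f g : ℕ → A} n → applyUpTo f n ≡ applyUpTo g n → ∀ {k} → k < n → f k ≡ g k
  applyUpTo-injective (suc n) eq {zero}  _         = ∷-injectiveˡ eq
  applyUpTo-injective (suc n) eq {suc k} (s≤s k<n) = applyUpTo-injective n (∷-injectiveʳ eq) k<n

  drop-applyUpTo : ∀ (f : ℕ → A) a n → drop a (applyUpTo f n) ≡ applyUpTo (λ k → f (a + k)) (n ∸ a)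
  drop-applyUpTo f zero    n       = refl
  drop-applyUpTo f (suc a) zero    = refl
  drop-applyUpTo f (suc a) (suc n) = drop-applyUpTo (λ k → f (suc k)) a n

  applyUpTo-prefix : ∀ (f g : ℕ → A) n m q → applyUpTo f n ≡ applyUpTo g m ++ q →
    m ≤ n × (∀ {k} → k < m → f k ≡ g k)
  applyUpTo-prefix f g n       zero    q eq = z≤n , λ ()
  applyUpTo-prefix f g zero    (suc m) q ()
  applyUpTo-prefix f g (suc n) (suc m) q eq
    with m≤n , agree ← applyUpTo-prefix (λ k → f (suc k)) (λ k → g (suc k)) n m q (∷-injectiveʳ eq) =
    s≤s m≤n , λ { {zero} _ → ∷-injectiveˡ eq ; {suc k} (s≤s k<m) → agree k<m }

  applyUpTo-occurrence : ∀ (f g : ℕ → A) n m p q → applyUpTo f n ≡ p ++ applyUpTo g m ++ q →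
    length p + m ≤ n × (∀ {k} → k < m → f (length p + k) ≡ g k)
  applyUpTo-occurrence f g n       m []      q eq = applyUpTo-prefix f g n m q eq
  applyUpTo-occurrence f g zero    m (_ ∷ p) q ()
  applyUpTo-occurrence f g (suc n) m (_ ∷ p) q eq
    with bound , agree ← applyUpTo-occurrence (λ k → f (suc k)) g n m p q (∷-injectiveʳ eq) = s≤s bound , agree

  reverse-applyUpTo′ : ∀ (f : ℕ → A) n → reverse (applyUpTo f n) ≡ applyUpTo (λ k → f (n ∸ suc k)) n
  reverse-applyUpTo′ f zero    = refl
  reverse-applyUpTo′ f (suc n) = begin
    reverse (applyUpTo f (suc n))             ≡⟨ cong reverse (applyUpTo-∷ʳ f n) ⟨
    reverse (applyUpTo f n ∷ʳ f n)            ≡⟨ reverse-++ (applyUpTo f n) [ f n ] ⟩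
    f n ∷ reverse (applyUpTo f n)             ≡⟨ cong (f n ∷_) (reverse-applyUpTo′ f n) ⟩
    f n ∷ applyUpTo (λ k → f (n ∸ suc k)) n   ∎
    where open ≡-Reasoning

least : ∀ {P : ℕ → Set} → (∀ n → Dec (P n)) → ∀ {m} → P m →
  ∃ λ i → i ≤ m × P i × (∀ {j} → j < i → ¬ P j)
least P? {m} Pm with P? 0
... | yes P0 = 0 , z≤n , P0 , λ ()
least P? {zero}  Pm | no ¬P0 = contradiction Pm ¬P0
least P? {suc m} Pm | no ¬P0 with i , i≤m , Pi , below ← least (λ n → P? (suc n)) Pm =
  suc i , s≤s i≤m , Pi , λ { {zero} _ → ¬P0 ; {suc j} (s≤s j<i) → below j<i }

Factor : Word → Word → Set
Factor u x = ∃₂ λ p q → x ≡ p ++ u ++ q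

∈-factorsWithRep⁻ : ∀ {u x} → u ∈ factorsWithRep x → Factor u x
∈-factorsWithRep⁻ (here refl) = [] , _ , refl
∈-factorsWithRep⁻ {x = x} (there u∈) with i , _ , u∈ᵢ ← find (∈-concatMap⁻ _ {xs = upTo (length x)} u∈)
  with k , _ , refl ← ∈-map⁻ _ u∈ᵢ =
  take i x , drop (suc k) (drop i x) , (begin
    x                                                               ≡⟨ take++drop≡id i x ⟨
    take i x ++ drop i x                                            ≡⟨ cong (take i x ++_) (take++drop≡id (suc k) (drop i x)) ⟨
    take i x ++ take (suc k) (drop i x) ++ drop (suc k) (drop i x)  ∎)
  where open ≡-Reasoning

∈-factorsWithRep⁺ : ∀ {u x} → Factor u x → u ∈ factorsWithRep x
∈-factorsWithRep⁺ {[]}    _                = here refl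
∈-factorsWithRep⁺ {a ∷ u} (p , q , refl) =
  there (∈-concatMap⁺ factorsAt
    (lose (∈-upTo⁺ p<x) (subst (_∈ factorsAt (length p)) slice≡ (∈-map⁺ _ (∈-upTo⁺ u<rest)))))
  where
  x = p ++ (a ∷ u) ++ q
  factorsAt : ℕ → List Word
  factorsAt i = map (λ k → take (suc k) (drop i x)) (upTo (length x ∸ i))
  length-x : length x ≡ length p + suc (length u + length q)
  length-x = trans (length-++ p) (cong (λ n → length p + suc n) (length-++ u))
  p<x : length p < length x
  p<x = subst (length p <_) (sym length-x) (m<m+n (length p) (s≤s z≤n))
  u<rest : length u < length x ∸ length p
  u<rest = subst (length u <_) (sym (trans (cong (_∸ length p) length-x) (m+n∸m≡n (length p) _)))
                 (s≤s (m≤m+n (length u) (length q)))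
  slice≡ : take (suc (length u)) (drop (length p) x) ≡ a ∷ u
  slice≡ = trans (cong (take (suc (length u))) (drop-length-++ p _)) (take-length-++ (a ∷ u) q)

∈-palFactors⁻ : ∀ {u x} → u ∈ palFactors x → IsPalindrome u × Factor u x
∈-palFactors⁻ {x = x} u∈
  with u∈′ , pal ← ∈-filter⁻ isPalindrome? (∈-deduplicate⁻ _≟W_ (filter isPalindrome? (factorsWithRep x)) u∈) =
  pal , ∈-factorsWithRep⁻ u∈′

∈-palFactors⁺ : ∀ {u x} → IsPalindrome u → Factor u x → u ∈ palFactors x
∈-palFactors⁺ pal fac = Equivalence.to (deduplicate-∈⇔ _≟W_) (∈-filter⁺ isPalindrome? (∈-factorsWithRep⁺ fac) pal)

factor-∷ʳ⁺ : ∀ {u x} c → Factor u x → Factor u (x ∷ʳ c)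
factor-∷ʳ⁺ {u} c (p , q , refl) = p , q ∷ʳ c , (begin
  (p ++ u ++ q) ∷ʳ c   ≡⟨ ++-assoc p (u ++ q) [ c ] ⟩
  p ++ (u ++ q) ∷ʳ c   ≡⟨ cong (p ++_) (++-assoc u q [ c ]) ⟩
  p ++ u ++ q ∷ʳ c     ∎)
  where open ≡-Reasoning

factor-∷ʳ-not-suffix : ∀ {x c} p u s z → x ∷ʳ c ≡ p ++ u ++ s ∷ʳ z → Factor u x
factor-∷ʳ-not-suffix {x} {c} p u s z eq = p , s , ∷ʳ-injectiveˡ x (p ++ u ++ s) (begin
  x ∷ʳ c              ≡⟨ eq ⟩
  p ++ u ++ s ∷ʳ z    ≡⟨ cong (p ++_) (++-assoc u s [ z ]) ⟨
  p ++ (u ++ s) ∷ʳ z  ≡⟨ ++-assoc p (u ++ s) [ z ] ⟨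
  (p ++ u ++ s) ∷ʳ z  ∎)
  where open ≡-Reasoning

factor-∷ʳ⁻ : ∀ {u x c} → Factor u (x ∷ʳ c) → Factor u x ⊎ ∃ λ p → x ∷ʳ c ≡ p ++ u
factor-∷ʳ⁻ {u} (p , q , eq) with initLast q
... | []        = inj₂ (p , trans eq (cong (p ++_) (++-identityʳ u)))
... | q′ ∷ʳ′ z  = inj₁ (factor-∷ʳ-not-suffix p u q′ z eq)

proper-palindromic-suffix-factor : ∀ {x c} p a r e → x ∷ʳ c ≡ p ++ (a ∷ r) ++ e →
  IsPalindrome ((a ∷ r) ++ e) → IsPalindrome e → Factor e x
proper-palindromic-suffix-factor p a r e eq pal palₑ = factor-∷ʳ-not-suffix p e (reverse r) a (begin
  _                                  ≡⟨ eq ⟩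
  p ++ (a ∷ r) ++ e                  ≡⟨ cong (p ++_) pal ⟨
  p ++ reverse ((a ∷ r) ++ e)        ≡⟨ cong (p ++_) (reverse-++ (a ∷ r) e) ⟩
  p ++ reverse e ++ reverse (a ∷ r)  ≡⟨ cong (λ v → p ++ v ++ reverse (a ∷ r)) palₑ ⟩
  p ++ e ++ reverse (a ∷ r)          ≡⟨ cong (λ v → p ++ e ++ v) (unfold-reverse a r) ⟩
  p ++ e ++ reverse r ∷ʳ a           ∎)
  where open ≡-Reasoning

suffixes-comparable : ∀ (p u p′ e : Word) → p ++ u ≡ p′ ++ e →
  (∃ λ r → u ≡ r ++ e) ⊎ (∃ λ r → e ≡ r ++ u)
suffixes-comparable []      u p′       e eq = inj₁ (p′ , eq)
suffixes-comparable (a ∷ p) u []       e eq = inj₂ (a ∷ p , sym eq)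
suffixes-comparable (a ∷ p) u (_ ∷ p′) e eq = suffixes-comparable p u p′ e (∷-injectiveʳ eq)

palFactors-unique : ∀ x → Unique (palFactors x)
palFactors-unique x = deduplicate-! (filter isPalindrome? (factorsWithRep x))

-- The palindromic suffixes of x c are nested, and a shorter one reappears as a prefix of a longer one.
length-palFactors-∷ʳ : ∀ {x c} p u → x ∷ʳ c ≡ p ++ u → IsPalindrome u → ¬ Factor u x →
  length (palFactors (x ∷ʳ c)) ≡ suc (length (palFactors x))
length-palFactors-∷ʳ {x} {c} p u eq pal new =
  ↭-length (∼bag⇒↭ (unique∧set⇒bag (palFactors-unique (x ∷ʳ c)) unique (mk⇔ to from)))
  where
  unique : Unique (u ∷ palFactors x)
  unique = tabulate (λ e∈ u≡e → new (proj₂ (∈-palFactors⁻ (subst (_∈ palFactors x) (sym u≡e) e∈))))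
         ∷ palFactors-unique x
  to : ∀ {e} → e ∈ palFactors (x ∷ʳ c) → e ∈ u ∷ palFactors x
  to e∈ with palₑ , fac ← ∈-palFactors⁻ e∈ with factor-∷ʳ⁻ fac
  ... | inj₁ facₓ = there (∈-palFactors⁺ palₑ facₓ)
  ... | inj₂ (p′ , eq′) with suffixes-comparable p u p′ _ (trans (sym eq) eq′)
  ... | inj₁ ([] , u≡e)    = here (sym u≡e)
  ... | inj₁ (a ∷ r , u≡)  = there (∈-palFactors⁺ palₑ
        (proper-palindromic-suffix-factor p a r _ (subst (λ v → _ ≡ p ++ v) u≡ eq) (subst IsPalindrome u≡ pal) palₑ))
  ... | inj₂ ([] , e≡u)    = here e≡u
  ... | inj₂ (a ∷ r , e≡)  = ⊥-elim (new
        (proper-palindromic-suffix-factor p′ a r u (subst (λ v → _ ≡ p′ ++ v) e≡ eq′) (subst IsPalindrome e≡ palₑ) pal))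
  from : ∀ {e} → e ∈ u ∷ palFactors x → e ∈ palFactors (x ∷ʳ c)
  from (here refl) = ∈-palFactors⁺ pal (p , [] , trans eq (cong (p ++_) (sym (++-identityʳ u))))
  from (there e∈) with palₑ , fac ← ∈-palFactors⁻ {x = x} e∈ = ∈-palFactors⁺ palₑ (factor-∷ʳ⁺ c fac)

singleton-rich : ∀ b → Rich [ b ]
singleton-rich false = refl
singleton-rich true  = refl

applyUpTo-palindrome⁺ : ∀ (f : ℕ → Bool) n → (∀ {k} → k < n → f (n ∸ suc k) ≡ f k) →
  IsPalindrome (applyUpTo f n)
applyUpTo-palindrome⁺ f n reflected = trans (reverse-applyUpTo′ f n) (applyUpTo-cong n reflected)

applyUpTo-palindrome⁻ : ∀ (f : ℕ → Bool) n → IsPalindrome (applyUpTo f n) →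
  ∀ {k} → k < n → f (n ∸ suc k) ≡ f k
applyUpTo-palindrome⁻ f n pal = applyUpTo-injective n (trans (sym (reverse-applyUpTo′ f n)) pal)

module Modular (q : ℕ) where

  infix 4 _≋_
  -- A record rather than an abbreviation, so that x and y can be inferred from a proof.
  record _≋_ (x y : ℕ) : Set where
    constructor mk≋
    field %-≡ : x % suc q ≡ y % suc q
  open _≋_ public

  ≋-reflexive : ∀ {x y} → x ≡ y → x ≋ y
  ≋-reflexive x≡y = mk≋ (cong (_% suc q) x≡y)

  ≋-isEquivalence : IsEquivalence _≋_
  ≋-isEquivalence = record
    { refl  = mk≋ refl
    ; sym   = λ (mk≋ e) → mk≋ (sym e)
    ; trans = λ (mk≋ e) (mk≋ f) → mk≋ (trans e f)
    }

  ≋-setoid : Setoid _ _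
  ≋-setoid = record { isEquivalence = ≋-isEquivalence }

  open IsEquivalence ≋-isEquivalence public using () renaming (sym to ≋-sym; trans to ≋-trans)

  %-≋ : ∀ x → x % suc q ≋ x
  %-≋ x = mk≋ (m%n%n≡m%n x (suc q))

  +-multiple-≋ : ∀ x k → x + k * suc q ≋ x
  +-multiple-≋ x k = mk≋ ([m+kn]%n≡m%n x k (suc q))

  +-congʳ : ∀ {x y} z → x ≋ y → x + z ≋ y + z
  +-congʳ {x} {y} z (mk≋ e) = mk≋ (begin
    (x + z) % suc q                      ≡⟨ %-distribˡ-+ x z (suc q) ⟩
    (x % suc q + z % suc q) % suc q      ≡⟨ cong (λ t → (t + z % suc q) % suc q) e ⟩
    (y % suc q + z % suc q) % suc q      ≡⟨ %-distribˡ-+ y z (suc q) ⟨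
    (y + z) % suc q                      ∎)
    where open ≡-Reasoning

  +-congˡ : ∀ {x y} z → x ≋ y → z + x ≋ z + y
  +-congˡ {x} {y} z x≋y = begin
    z + x ≡⟨ +-comm z x ⟩
    x + z ≈⟨ +-congʳ z x≋y ⟩
    y + z ≡⟨ +-comm y z ⟩
    z + y ∎
    where open import Relation.Binary.Reasoning.Setoid ≋-setoid

  complement : ∀ x → ∃ λ k → k ≤ q × x + k ≋ 0
  complement x = k , ≤-pred (m%n<n c (suc q)) , (begin
    x + c % suc q           ≈⟨ +-congˡ x (%-≋ c) ⟩
    x + c                   ≈⟨ +-congʳ c (%-≋ x) ⟨
    x % suc q + c           ≡⟨ m+[n∸m]≡n (<⇒≤ (m%n<n x (suc q))) ⟩
    suc q                   ≈⟨ mk≋ (n%n≡0 (suc q)) ⟩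
    0                       ∎)
    where
    open import Relation.Binary.Reasoning.Setoid ≋-setoid
    c = suc q ∸ x % suc q
    k = c % suc q

  +-cancelʳ : ∀ {x y} z → x + z ≋ y + z → x ≋ y
  +-cancelʳ {x} {y} z x+z≋y+z with c , _ , z+c≋0 ← complement z = begin
    x               ≡⟨ +-identityʳ x ⟨
    x + 0           ≈⟨ +-congˡ x z+c≋0 ⟨
    x + (z + c)     ≡⟨ +-assoc x z c ⟨
    (x + z) + c     ≈⟨ +-congʳ c x+z≋y+z ⟩
    (y + z) + c     ≡⟨ +-assoc y z c ⟩
    y + (z + c)     ≈⟨ +-congˡ y z+c≋0 ⟩
    y + 0           ≡⟨ +-identityʳ y ⟩
    y               ∎
    where open import Relation.Binary.Reasoning.Setoid ≋-setoid

  choose : ∀ a x → ∃ λ k → k ≤ q × a + k ≋ x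
  choose a x with c , _ , a+c≋0 ← complement a =
    (x + c) % suc q , ≤-pred (m%n<n (x + c) (suc q)) , (begin
    a + (x + c) % suc q   ≈⟨ +-congˡ a (%-≋ (x + c)) ⟩
    a + (x + c)           ≡⟨ rearrange a x c ⟩
    x + (a + c)           ≈⟨ +-congˡ x a+c≋0 ⟩
    x + 0                 ≡⟨ +-identityʳ x ⟩
    x                     ∎)
    where
    open import Relation.Binary.Reasoning.Setoid ≋-setoid
    rearrange : ∀ a x c → a + (x + c) ≡ x + (a + c)
    rearrange = solve-∀

  -- residue z ≡ z and offset b j ≡ j - b modulo suc q, since q ≡ -1.
  residue : ℤ → ℕ
  residue (+ n)    = n
  residue -[1+ n ] = q * suc n

  residue-suc : ∀ z → residue (z +ℤ + 1) ≋ suc (residue z)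
  residue-suc (+ n)        = ≋-reflexive (+-comm n 1)
  residue-suc -[1+ zero ]  = ≋-sym (≋-trans (≋-reflexive (rearrange q)) (+-multiple-≋ 0 1))
    where
    rearrange : ∀ q → suc (q * 1) ≡ 0 + 1 * suc q
    rearrange = solve-∀
  residue-suc -[1+ suc n ] = ≋-sym (≋-trans (≋-reflexive (rearrange q n)) (+-multiple-≋ (q * suc n) 1))
    where
    rearrange : ∀ q n → suc (q * suc (suc n)) ≡ q * suc n + 1 * suc q
    rearrange = solve-∀

  residue-+ : ∀ z k → residue (z +ℤ + k) ≋ residue z + k
  residue-+ z zero    = ≋-reflexive (trans (cong residue (ℤ.+-identityʳ z)) (sym (+-identityʳ (residue z))))
  residue-+ z (suc k) = begin
    residue (z +ℤ + suc k)         ≡⟨ cong residue (ℤ.+-assoc z (+ 1) (+ k)) ⟨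
    residue ((z +ℤ + 1) +ℤ + k)    ≈⟨ residue-+ (z +ℤ + 1) k ⟩
    residue (z +ℤ + 1) + k         ≈⟨ +-congʳ k (residue-suc z) ⟩
    suc (residue z) + k            ≡⟨ +-suc (residue z) k ⟨
    residue z + suc k              ∎
    where open import Relation.Binary.Reasoning.Setoid ≋-setoid

  offset : ℤ → ℤ → ℕ
  offset b j = residue j + q * residue b

  offset-+ : ∀ b j k → offset b (j +ℤ + k) ≋ offset b j + k
  offset-+ b j k = begin
    residue (j +ℤ + k) + q * residue b   ≈⟨ +-congʳ (q * residue b) (residue-+ j k) ⟩
    (residue j + k) + q * residue b      ≡⟨ rearrange (residue j) k (q * residue b) ⟩
    offset b j + k                       ∎
    where
    open import Relation.Binary.Reasoning.Setoid ≋-setoid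
    rearrange : ∀ x k c → (x + k) + c ≡ (x + c) + k
    rearrange = solve-∀

  offset-origin : ∀ b r → offset b (b +ℤ + r) ≋ r
  offset-origin b r = begin
    residue (b +ℤ + r) + q * residue b   ≈⟨ offset-+ b b r ⟩
    (residue b + q * residue b) + r      ≡⟨ rearrange q (residue b) r ⟩
    r + residue b * suc q                ≈⟨ +-multiple-≋ r (residue b) ⟩
    r                                    ∎
    where
    open import Relation.Binary.Reasoning.Setoid ≋-setoid
    rearrange : ∀ q x r → (x + q * x) + r ≡ r + x * suc q
    rearrange = solve-∀

window : (ℕ → Bool) → ℕ → ℕ → Word
window Y s n = applyUpTo (λ k → Y (s + k)) (suc n)

window-∷ʳ : ∀ Y s n → window Y s n ∷ʳ Y (s + suc n) ≡ window Y s (suc n)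
window-∷ʳ Y s n = applyUpTo-∷ʳ (λ k → Y (s + k)) (suc n)

window-cong : ∀ {Y Z : ℕ → Bool} s n → (∀ k → Y k ≡ Z k) → window Y s n ≡ window Z s n
window-cong s n Y≗Z = applyUpTo-cong (suc n) λ {k} _ → Y≗Z (s + k)

module PeriodicWord (q : ℕ) (Y : ℕ → Bool) (Y-cong : ∀ {x y} → Modular._≋_ q x y → Y x ≡ Y y) where

  open Modular q

  SymmetricAbout : ℕ → Set
  SymmetricAbout σ = ∀ {x y} → x + y ≋ σ → Y x ≡ Y y

  HasPeriod : ℕ → Set
  HasPeriod d = ∀ x → Y x ≡ Y (x + d)

  symmetricAbout-cong : ∀ {σ σ′} → σ ≋ σ′ → SymmetricAbout σ → SymmetricAbout σ′
  symmetricAbout-cong σ≋σ′ sym-σ x+y≋σ′ = sym-σ (≋-trans x+y≋σ′ (≋-sym σ≋σ′))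

  symmetricAbout-period : ∀ {σ d} → HasPeriod d → SymmetricAbout (σ + d) → SymmetricAbout σ
  symmetricAbout-period {σ} {d} period sym-σ+d {x} {y} x+y≋σ =
    trans (period x) (sym-σ+d (≋-trans (≋-reflexive (rearrange x d y)) (+-congʳ d x+y≋σ)))
    where
    rearrange : ∀ x d y → (x + d) + y ≡ (x + y) + d
    rearrange = solve-∀

  period-of-agreement : ∀ t d → (∀ {k} → k ≤ q → Y (t + k) ≡ Y (t + k + d)) → HasPeriod d
  period-of-agreement t d agree x with k , k≤q , t+k≋x ← choose t x =
    trans (Y-cong (≋-sym t+k≋x)) (trans (agree k≤q) (Y-cong (+-congʳ d t+k≋x)))

  reflected-index-sum : ∀ s {n k} → k ≤ n → (s + (n ∸ k)) + (s + k) ≡ s + (s + n)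
  reflected-index-sum s {n} {k} k≤n = trans (rearrange s (n ∸ k) k) (cong (λ t → s + (s + t)) (m∸n+n≡m k≤n))
    where
    rearrange : ∀ s t k → (s + t) + (s + k) ≡ s + (s + (t + k))
    rearrange = solve-∀

  window-palindrome⁺ : ∀ s n → SymmetricAbout (s + (s + n)) → IsPalindrome (window Y s n)
  window-palindrome⁺ s n symmetric =
    applyUpTo-palindrome⁺ (λ k → Y (s + k)) (suc n)
      λ { {k} (s≤s k≤n) → symmetric {s + (n ∸ k)} (≋-reflexive (reflected-index-sum s k≤n)) }

  reflected-index-≋ : ∀ s {n k x y} → k ≤ n → x + y ≋ s + (s + n) → s + k ≋ x → s + (n ∸ k) ≋ y
  reflected-index-≋ s {n} {k} {x} {y} k≤n x+y≋c s+k≋x = +-cancelʳ (s + k) (begin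
    (s + (n ∸ k)) + (s + k)  ≡⟨ reflected-index-sum s k≤n ⟩
    s + (s + n)              ≈⟨ x+y≋c ⟨
    x + y                    ≡⟨ +-comm x y ⟩
    y + x                    ≈⟨ +-congˡ y s+k≋x ⟨
    y + (s + k)              ∎)
    where open import Relation.Binary.Reasoning.Setoid ≋-setoid

  window-palindrome⁻ : ∀ s n → q ≤ n → IsPalindrome (window Y s n) → SymmetricAbout (s + (s + n))
  window-palindrome⁻ s n q≤n pal {x} {y} x+y≋c with k , k≤q , s+k≋x ← choose s x = begin
    Y x              ≡⟨ Y-cong (≋-sym s+k≋x) ⟩
    Y (s + k)        ≡⟨ applyUpTo-palindrome⁻ (λ k → Y (s + k)) (suc n) pal (s≤s k≤n) ⟨
    Y (s + (n ∸ k))  ≡⟨ Y-cong (reflected-index-≋ s k≤n x+y≋c s+k≋x) ⟩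
    Y y              ∎
    where
    open ≡-Reasoning
    k≤n = ≤-trans k≤q q≤n

  drop-window : ∀ s {a n} → a ≤ n → drop a (window Y s n) ≡ window Y (s + a) (n ∸ a)
  drop-window s {a} {n} a≤n = begin
    drop a (window Y s n)                             ≡⟨ drop-applyUpTo (λ k → Y (s + k)) a (suc n) ⟩
    applyUpTo (λ k → Y (s + (a + k))) (suc n ∸ a)     ≡⟨ cong (applyUpTo (λ k → Y (s + (a + k)))) (+-∸-assoc 1 a≤n) ⟩
    applyUpTo (λ k → Y (s + (a + k))) (suc (n ∸ a))   ≡⟨ applyUpTo-cong (suc (n ∸ a)) (λ {k} _ → cong Y (+-assoc s a k)) ⟨
    window Y (s + a) (n ∸ a)                          ∎
    where open ≡-Reasoning

  suffix-centre : ∀ s {a n} → a ≤ n → (s + a) + ((s + a) + (n ∸ a)) ≡ (s + a) + (s + n)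
  suffix-centre s {a} a≤n = cong (λ t → (s + a) + t) (trans (+-assoc s a _) (cong (λ t → s + t) (m+[n∸m]≡n a≤n)))

  suffix-palindrome⁺ : ∀ s {a n} → a ≤ n → SymmetricAbout ((s + a) + (s + n)) →
    IsPalindrome (drop a (window Y s n))
  suffix-palindrome⁺ s {a} {n} a≤n symmetric = subst IsPalindrome (sym (drop-window s a≤n))
    (window-palindrome⁺ (s + a) (n ∸ a) (subst SymmetricAbout (sym (suffix-centre s a≤n)) symmetric))

  suffix-palindrome⁻ : ∀ s {a n} → a ≤ n → q ≤ n ∸ a → IsPalindrome (drop a (window Y s n)) →
    SymmetricAbout ((s + a) + (s + n))
  suffix-palindrome⁻ s {a} {n} a≤n long pal = subst SymmetricAbout (suffix-centre s a≤n)
    (window-palindrome⁻ (s + a) (n ∸ a) long (subst IsPalindrome (drop-window s a≤n) pal))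

  window-occurrence : ∀ s n t m → Factor (window Y t m) (window Y s n) →
    ∃ λ p → p + suc m ≤ suc n × (∀ {k} → k ≤ m → Y (s + (p + k)) ≡ Y (t + k))
  window-occurrence s n t m (P , Q , eq) =
    let bound , agree = applyUpTo-occurrence (λ k → Y (s + k)) (λ k → Y (t + k)) (suc n) (suc m) P Q eq
    in length P , bound , λ k≤m → agree (s≤s k≤m)

  palindromic-suffix-within-period : SymmetricAbout 0 → ∀ s n → q ≤ n →
    ∃ λ a → a ≤ q × IsPalindrome (drop a (window Y s n))
  palindromic-suffix-within-period symmetric-0 s n q≤n with a , a≤q , c+a≋0 ← complement (s + (s + n)) =
    a , a≤q , suffix-palindrome⁺ s (≤-trans a≤q q≤n) (symmetricAbout-cong centre≋0 symmetric-0)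
    where
    rearrange : ∀ s a n → (s + a) + (s + n) ≡ (s + (s + n)) + a
    rearrange = solve-∀
    centre≋0 : 0 ≋ (s + a) + (s + n)
    centre≋0 = ≋-sym (≋-trans (≋-reflexive (rearrange s a n)) c+a≋0)

  occurring-suffix⇒earlier-palindromic-suffix : ∀ s n {i} → i ≤ suc n → q ≤ suc n ∸ i →
    IsPalindrome (drop i (window Y s (suc n))) → Factor (drop i (window Y s (suc n))) (window Y s n) →
    ∃ λ p → p < i × IsPalindrome (drop p (window Y s (suc n)))
  occurring-suffix⇒earlier-palindromic-suffix s n {i} i≤N long pal occurs
    with p , bound , agree ← window-occurrence s n (s + i) (suc n ∸ i)
                               (subst (λ u → Factor u (window Y s n)) (drop-window s i≤N) occurs) =
    p , p<i , suffix-palindrome⁺ s (<⇒≤ (<-≤-trans p<i i≤N)) (symmetricAbout-period period symmetric-shifted)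
    where
    open ≡-Reasoning
    r = suc n ∸ i
    p<i : p < i
    p<i = +-cancelʳ-≤ r (suc p) i (subst₂ _≤_ (+-suc p r) (sym (m+[n∸m]≡n i≤N)) bound)
    d = i ∸ p
    p+d≡i : p + d ≡ i
    p+d≡i = m+[n∸m]≡n (<⇒≤ p<i)
    rearrange₁ : ∀ s p d k → (s + p) + k + d ≡ s + (p + d) + k
    rearrange₁ = solve-∀
    period : HasPeriod d
    period = period-of-agreement (s + p) d λ {k} k≤q → begin
      Y (s + p + k)        ≡⟨ cong Y (+-assoc s p k) ⟩
      Y (s + (p + k))      ≡⟨ agree (≤-trans k≤q long) ⟩
      Y (s + i + k)        ≡⟨ cong (λ t → Y (s + t + k)) p+d≡i ⟨
      Y (s + (p + d) + k)  ≡⟨ cong Y (rearrange₁ s p d k) ⟨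
      Y (s + p + k + d)    ∎
    rearrange₂ : ∀ s p N d → s + (p + d) + (s + N) ≡ (s + p + (s + N)) + d
    rearrange₂ = solve-∀
    symmetric-shifted : SymmetricAbout ((s + p + (s + suc n)) + d)
    symmetric-shifted =
      subst SymmetricAbout (trans (cong (λ t → s + t + (s + suc n)) (sym p+d≡i)) (rearrange₂ s p (suc n) d))
            (suffix-palindrome⁻ s i≤N long pal)

  unioccurrent-palindromic-suffix : SymmetricAbout 0 → ∀ s n → q + q ≤ suc n →
    ∃ λ i → IsPalindrome (drop i (window Y s (suc n))) × ¬ Factor (drop i (window Y s (suc n))) (window Y s n)
  unioccurrent-palindromic-suffix symmetric-0 s n long
    with a , a≤q , pal-a ← palindromic-suffix-within-period symmetric-0 s (suc n) (≤-trans (m≤n+m q q) long)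
    with i , i≤a , pal-i , below ← least (λ j → isPalindrome? (drop j (window Y s (suc n)))) pal-a =
    i , pal-i , λ occurs →
      let p , p<i , pal-p = occurring-suffix⇒earlier-palindromic-suffix s n i≤N suffix-long pal-i occurs
      in below p<i pal-p
    where
    i≤q = ≤-trans i≤a a≤q
    i≤N = ≤-trans i≤q (≤-trans (m≤n+m q q) long)
    suffix-long : q ≤ suc n ∸ i
    suffix-long = ≤-trans (≤-reflexive (sym (m+n∸m≡n q q))) (∸-mono long i≤q)

  length-palFactors-window-suc : SymmetricAbout 0 → ∀ s n → q + q ≤ suc n →
    length (palFactors (window Y s (suc n))) ≡ suc (length (palFactors (window Y s n)))
  length-palFactors-window-suc symmetric-0 s n long =
    let i , pal , new = unioccurrent-palindromic-suffix symmetric-0 s n long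
        y = window Y s (suc n)
    in subst (λ z → length (palFactors z) ≡ suc (length (palFactors (window Y s n)))) (window-∷ʳ Y s n)
             (length-palFactors-∷ʳ (take i y) (drop i y) (trans (window-∷ʳ Y s n) (sym (take++drop≡id i y))) pal new)

  window-residue : ∀ s n → window Y s n ≡ window Y (s % suc q) n
  window-residue s n = applyUpTo-cong (suc n) λ {k} _ → Y-cong (+-congʳ k (≋-sym (%-≋ s)))

  windows-rich : SymmetricAbout 0 → (∀ {s n} → s < suc q → n < q + q → Rich (window Y s n)) →
    ∀ s n → Rich (window Y s n)
  windows-rich symmetric-0 short s zero    = singleton-rich (Y (s + 0))
  windows-rich symmetric-0 short s (suc n) with suc n <? q + q
  ... | yes n<2q = subst Rich (sym (window-residue s (suc n))) (short (m%n<n s (suc q)) n<2q)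
  ... | no  n≮2q = begin
    length (palFactors (window Y s (suc n)))  ≡⟨ length-palFactors-window-suc symmetric-0 s n (≮⇒≥ n≮2q) ⟩
    suc (length (palFactors (window Y s n)))  ≡⟨ cong suc (windows-rich symmetric-0 short s n) ⟩
    suc (length (window Y s n) + 1)           ≡⟨ cong (λ L → suc (L + 1)) (length-applyUpTo (λ k → Y (s + k)) (suc n)) ⟩
    suc (suc n) + 1                           ≡⟨ cong (_+ 1) (length-applyUpTo (λ k → Y (s + k)) (suc (suc n))) ⟨
    length (window Y s (suc n)) + 1           ∎
    where open ≡-Reasoning

-- Only applied to residues mod 10; the last clause is junk beyond 9.
mirror : ℕ → ℕ
mirror 6 = 4
mirror 7 = 3
mirror 8 = 2
mirror 9 = 1
mirror ρ = ρ

reflect : (ℕ → Bool) → ℕ → Bool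
reflect H k = H (mirror (k % 10))

cells : Bool → Bool → Bool → Bool → Bool → Bool → ℕ → Bool
cells b₀ _  _  _  _  _  0 = b₀
cells _  b₁ _  _  _  _  1 = b₁
cells _  _  b₂ _  _  _  2 = b₂
cells _  _  _  b₃ _  _  3 = b₃
cells _  _  _  _  b₄ _  4 = b₄
cells _  _  _  _  _  b₅ _ = b₅

∀-Bool? : ∀ {P : Bool → Set} → (∀ b → Dec (P b)) → Dec (∀ b → P b)
∀-Bool? P? = map′ (λ { (Pf , Pt) false → Pf ; (Pf , Pt) true → Pt }) (λ P → P false , P true) (P? false ×-dec P? true)

rich? : ∀ x → Dec (Rich x)
rich? x = length (palFactors x) ≟ length x + 1

ShortWindowsRich : (ℕ → Bool) → Set
ShortWindowsRich H = ∀ {s} → s < 10 → ∀ {n} → n < 18 → Rich (window (reflect H) s n)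

shortWindowsRich? : ∀ H → Dec (ShortWindowsRich H)
shortWindowsRich? H = allUpTo? (λ s → allUpTo? (λ n → rich? (window (reflect H) s n)) 18) 10

short-windows-rich : ∀ b₀ b₁ b₂ b₃ b₄ b₅ → ShortWindowsRich (cells b₀ b₁ b₂ b₃ b₄ b₅)
short-windows-rich = toWitness
  {a? = ∀-Bool? λ b₀ → ∀-Bool? λ b₁ → ∀-Bool? λ b₂ → ∀-Bool? λ b₃ → ∀-Bool? λ b₄ → ∀-Bool? λ b₅ →
        shortWindowsRich? (cells b₀ b₁ b₂ b₃ b₄ b₅)} _

mirror-symmetric : ∀ {ρ} → ρ < 10 → ∀ {ρ′} → ρ′ < 10 → (ρ + ρ′) % 10 ≡ 0 → mirror ρ ≡ mirror ρ′
mirror-symmetric = toWitness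
  {a? = allUpTo? (λ ρ → allUpTo? (λ ρ′ → ((ρ + ρ′) % 10 ≟ 0) →-dec (mirror ρ ≟ mirror ρ′)) 10) 10} _

mirror-<6 : ∀ {ρ} → ρ < 10 → mirror ρ < 6
mirror-<6 = toWitness {a? = allUpTo? (λ ρ → mirror ρ <? 6) 10} _

mirror-fixes : ∀ {r} → r < 6 → mirror r ≡ r
mirror-fixes = toWitness {a? = allUpTo? (λ r → mirror r ≟ r) 6} _

open Modular 9

reflect-cong : ∀ (H : ℕ → Bool) {x y} → x ≋ y → reflect H x ≡ reflect H y
reflect-cong H (mk≋ e) = cong (λ ρ → H (mirror ρ)) e

module Reflected (H : ℕ → Bool) = PeriodicWord 9 (reflect H) (reflect-cong H)

reflect-symmetric : ∀ (H : ℕ → Bool) {x y} → x + y ≋ 0 → reflect H x ≡ reflect H y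
reflect-symmetric H {x} {y} (mk≋ x+y≡0) = cong H (mirror-symmetric (m%n<n x 10) (m%n<n y 10)
  (trans (sym (%-distribˡ-+ x y 10)) x+y≡0))

cells-agree : ∀ (H : ℕ → Bool) {c} → c < 6 → cells (H 0) (H 1) (H 2) (H 3) (H 4) (H 5) c ≡ H c
cells-agree H {0} _ = refl
cells-agree H {1} _ = refl
cells-agree H {2} _ = refl
cells-agree H {3} _ = refl
cells-agree H {4} _ = refl
cells-agree H {5} _ = refl
cells-agree H {suc (suc (suc (suc (suc (suc _)))))} (s≤s (s≤s (s≤s (s≤s (s≤s (s≤s ()))))))

reflect-cells : ∀ (H : ℕ → Bool) k → reflect (cells (H 0) (H 1) (H 2) (H 3) (H 4) (H 5)) k ≡ reflect H k
reflect-cells H k = cells-agree H (mirror-<6 (m%n<n k 10))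

reflect-windows-rich : ∀ (H : ℕ → Bool) s n → Rich (window (reflect H) s n)
reflect-windows-rich H =
  Reflected.windows-rich H (λ {x} {y} → reflect-symmetric H {x} {y}) λ {s} {n} s<10 n<18 →
    subst Rich (window-cong s n (reflect-cells H)) (short-windows-rich (H 0) (H 1) (H 2) (H 3) (H 4) (H 5) s<10 n<18)

reflect-line : ∀ (H : ℕ → Bool) b j n →
  map (λ k → reflect H (offset b (j +ℤ + k))) (upTo (suc n)) ≡ window (reflect H) (offset b j) n
reflect-line H b j n = trans (map-upTo _ (suc n)) (applyUpTo-cong (suc n) λ {k} _ → reflect-cong H (offset-+ b j k))

reflect-origin : ∀ (H : ℕ → Bool) a {r} → r < 6 → reflect H (offset a (a +ℤ + r)) ≡ H r
reflect-origin H a {r} r<6 =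
  cong H (trans (cong mirror (trans (%-≡ (offset-origin a r)) (m<n⇒m%n≡m (<-≤-trans r<6 (m≤m+n 6 4))))) (mirror-fixes r<6))

within : ∀ {a i} → a ≤ℤ i → i ≤ℤ a +ℤ + 5 → ∃ λ r → r < 6 × i ≡ a +ℤ + r
within {a} {i} a≤i i≤a+5 = ∣ i - a ∣ , s≤s (ℤ.drop‿+≤+ r≤5) , trans (split i a) (cong (a +ℤ_) (sym r≡))
  where
  r≡ : + ∣ i - a ∣ ≡ i - a
  r≡ = ℤ.0≤i⇒+∣i∣≡i (ℤ.i≤j⇒0≤j-i a≤i)
  split : ∀ i a → i ≡ a +ℤ (i - a)
  split = ℤ-Solver.solve-∀
  cancel : ∀ a → (a +ℤ + 5) - a ≡ + 5
  cancel = ℤ-Solver.solve-∀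
  r≤5 : + ∣ i - a ∣ ≤ℤ + 5
  r≤5 = subst₂ _≤ℤ_ (sym r≡) (cancel a) (ℤ.+-monoˡ-≤ (- a) i≤a+5)

module Extension (w : Word2D) (a b : ℤ) where

  entry : ℕ → ℕ → Bool
  entry r c = fromMaybe false (w (a +ℤ + r) (b +ℤ + c))

  row : ℤ → ℕ → Bool
  row i = entry (mirror (offset a i % 10))

  column : ℤ → ℕ → Bool
  column j r = reflect (entry r) (offset b j)

  -- plane i j also reduces to reflect (row i) (offset b j).
  plane : Plane
  plane i j = reflect (column j) (offset a i)

  plane-rich : RichPlane plane
  plane-rich i j n =
    subst Rich (sym (reflect-line (row i) b j n)) (reflect-windows-rich (row i) (offset b j) n) ,
    subst Rich (sym (reflect-line (column j) a i n)) (reflect-windows-rich (column j) (offset a i) n)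

  plane-extends : (∀ i j → w i j ≢ nothing → (a ≤ℤ i × i ≤ℤ a +ℤ + 5) × (b ≤ℤ j × j ≤ℤ b +ℤ + 5)) →
    Extends plane w
  plane-extends support i j x w≡x
    with (a≤i , i≤a+5) , (b≤j , j≤b+5) ←
           support i j (λ w≡nothing → contradiction (trans (sym w≡x) w≡nothing) λ ())
    with r , r<6 , refl ← within a≤i i≤a+5
    with c , c<6 , refl ← within b≤j j≤b+5 = begin
      plane (a +ℤ + r) (b +ℤ + c)  ≡⟨ reflect-origin (column (b +ℤ + c)) a r<6 ⟩
      column (b +ℤ + c) r          ≡⟨ reflect-origin (entry r) b c<6 ⟩
      entry r c                    ≡⟨ cong (fromMaybe false) w≡x ⟩
      x                            ∎
    where open ≡-Reasoning

mainTheorem18 : (w : Word2D) → SupportIn6x6 w → CanBeExtendedToRichPlane w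
mainTheorem18 w (a , b , support) = plane , plane-extends support , plane-rich
  where open Extension w a b
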